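{- Let $p$ be a prime, $M$ an integer and $N$ an integer with $p^2>N\ge1$. The linear complexity $L_p(M;N)$ of the sequence $q_p(u)$, $u=M+1,\ldots,M+N$ (regarded as a sequence of elements of $\mathbb F_p$), satisfies $$L_p(M;N)\ge\min\Big\{\frac{p-1}{2},\,\frac{N-p-1}{3}\Big\}.$$
   Context: For a prime $p$ and an integer $u$ with $\gcd(u,p)=1$, the Fermat quotient $q_p(u)$ is the unique integer with $q_p(u)\equiv (u^{p-1}-1)/p \pmod p$ and $0\le q_p(u)\le p-1$; also $q_p(kp)=0$ for all $k\in\mathbb Z$. The linear complexity of an $N$-element sequence $s_0,\ldots,s_{N-1}$ in a ring $\mathcal R$ is the smallest integer $L\ge0$ such that there exist $c_0,\ldots,c_{L-1}\in\mathcal R$ with $s_{u+L}=c_{L-1}s_{u+L-1}+\cdots+c_0s_u$ for all $0\le u\le N-L-1$. -}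

module Defs where

open import Data.Nat as ℕ using (ℕ; zero; suc; NonZero)
open import Data.Nat.Divisibility using (_∣?_)
open import Data.Integer as ℤ using (ℤ; +_; ∣_∣; _/ℕ_; _%ℕ_)
open import Data.Integer.Divisibility as ℤD using ()
open import Data.Fin using (Fin; toℕ)
open import Data.Bool using (if_then_else_)
open import Relation.Nullary using (does)

-- Fermat quotient q_p(u) for an integer u:
--   q_p(u) = 0                                  if p ∣ u
--   q_p(u) = ((u^(p-1) - 1) / p) mod p  ∈ [0,p-1]  otherwise
-- (for p prime and p ∤ u, p divides u^(p-1) - 1 exactly, so the division is exact)
fermatQuotient : (p : ℕ) → .{{_ : NonZero p}} → ℤ → ℕ
fermatQuotient p u =
  if does (p ∣? ∣ u ∣)
    then 0
    else ((((u ℤ.^ (p ℕ.∸ 1)) ℤ.- ℤ.1ℤ) /ℕ p) %ℕ p)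

sumFin : (L : ℕ) → (Fin L → ℤ) → ℤ
sumFin zero    f = ℤ.0ℤ
sumFin (suc L) f = f Fin.zero ℤ.+ sumFin L (λ i → f (Fin.suc i))
  where import Data.Fin as Fin

_≡[mod_]_ : ℤ → ℕ → ℤ → Set
a ≡[mod p ] b = (+ p) ℤD.∣ (a ℤ.- b)

-- The N-element sequence s_0,…,s_{N-1} (given as s : ℕ → ℤ, only indices < N matter),
-- regarded in F_p = ℤ/pℤ, satisfies a linear recurrence of length L with coefficients
-- c_0,…,c_{L-1} ∈ F_p (represented by integers):
--   s_{u+L} = c_{L-1} s_{u+L-1} + … + c_0 s_u   for all 0 ≤ u ≤ N-L-1.
HasLinRec : (p N : ℕ) → (ℕ → ℤ) → ℕ → Set
HasLinRec p N s L =
  Σ (Fin L → ℤ) λ c →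
    ∀ (u : ℕ) → u ℕ.+ L ℕ.< N →
      s (u ℕ.+ L) ≡[mod p ] sumFin L (λ i → c i ℤ.* s (u ℕ.+ toℕ i))
  where open import Data.Product using (Σ)

IsLinearComplexity : (p N : ℕ) → (ℕ → ℤ) → ℕ → Set
IsLinearComplexity p N s L =
  HasLinRec p N s L × (∀ L' → HasLinRec p N s L' → L ℕ.≤ L')
  where open import Data.Product using (_×_)

-- For x prime to p the Fermat quotient satisfies q(x + p) − q(x) ≡ −1/x (mod p), a consequence of
-- Fermat's little theorem and of (x + p)^(p−1) ≡ x^(p−1) + (p−1) p x^(p−2) (mod p²).
-- A recurrence of length L for s(u) = q(M + 1 + u) is inherited by t(u) = s(u + p) − s(u) whenever
-- u + L + p < N, and with t(u + j) ≡ −1/(x + j), x = M + 1 + u, it says that the numerator F(x) of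
-- −1/(x + L) + Σ_{i<L} c_i/(x + i), a polynomial with L + 1 coefficients, vanishes mod p at x.
-- If 2L + 1 < p and 3L + 1 + p < N there are L + 1 such u ≤ 2L + 1, pairwise incongruent mod p,
-- with none of M + 1 + u, …, M + 1 + u + L divisible by p. Hence F vanishes identically mod p,
-- but F(−L) = −∏_{j<L} (j − L) is prime to p.

module Submission where

open import Data.Nat as ℕ using (ℕ; zero; suc; NonZero; _<_; _≤_; _≥_; _>_; z≤n; s≤s; _!)
import Data.Nat.Properties as ℕₚ
open import Data.Nat.Primality using (Prime; euclidsLemma; ¬prime[1])
import Data.Nat.Divisibility as ℕᵈ
open import Data.Nat.Divisibility using (>⇒∤)
open import Data.Nat.Combinatorics using (_C_; nCk≡n!/k![n-k]!; k![n∸k]!∣n!; nCk≡nC[n∸k]; nCn≡1)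
open import Data.Nat.DivMod using (m/n*n≡m; m<n⇒m%n≡m)
open import Data.Nat.Tactic.RingSolver using () renaming (solve-∀ to ℕ-solve-∀)
open import Data.Integer as ℤ using (ℤ; +_; -_; _+_; _*_; _-_; _^_; 0ℤ; 1ℤ; _/ℕ_; _%ℕ_)
import Data.Integer.Properties as ℤₚ
open import Data.Integer.DivMod using (a≡a%ℕn+[a/ℕn]*n; n%ℕd<d)
open import Data.Integer.Divisibility.Signed
open import Data.Integer.Tactic.RingSolver using (solve-∀)
open import Data.Fin as Fin using (Fin; toℕ; fromℕ)
open import Data.Fin.Properties using (toℕ-fromℕ)
open import Data.Bool using (if_then_else_)
open import Data.Empty using (⊥; ⊥-elim)
open import Data.Product using (Σ; ∃; _×_; _,_; proj₁; proj₂)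
open import Data.Sum using (_⊎_; inj₁; inj₂; [_,_]′)
open import Data.Vec.Functional using (_∷_)
open import Function using (_∘_; id; flip)
open import Relation.Nullary using (¬_; Dec; yes; no; contradiction)
open import Relation.Nullary.Decidable using (dec-false)
open import Relation.Binary.PropositionalEquality
open import Algebra.Bundles using (CommutativeSemiring)
import Algebra.Properties.CommutativeSemiring.Binomial as Binomial
import Algebra.Definitions.RawSemiring as RawSemiring

open import Defs

-- Integer divisibility

euclidsLemmaℤ : ∀ {p} → Prime p → ∀ m n → + p ∣ m * n → + p ∣ m ⊎ + p ∣ n
euclidsLemmaℤ {p} p-prime m n p∣m*n
  with euclidsLemma ℤ.∣ m ∣ ℤ.∣ n ∣ p-prime (subst (p ℕᵈ.∣_) (ℤₚ.abs-* m n) (∣⇒∣ᵤ p∣m*n))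
... | inj₁ p∣m = inj₁ (∣ᵤ⇒∣ p∣m)
... | inj₂ p∣n = inj₂ (∣ᵤ⇒∣ p∣n)

0<n<p⇒p∤n : ∀ {p n} → 0 < n → n < p → ¬ (+ p ∣ + n)
0<n<p⇒p∤n {n = suc n} _ n<p p∣n = >⇒∤ n<p (∣⇒∣ᵤ p∣n)

p∤b-a : ∀ {p a b} → a < b → b < a ℕ.+ p → ¬ (+ p ∣ + b - + a)
p∤b-a {zero}  {a} a<b b<a+0 = contradiction (ℕₚ.<-trans a<b (subst (_ <_) (ℕₚ.+-identityʳ a) b<a+0)) (ℕₚ.<-irrefl refl)
p∤b-a {suc p} {a} {b} a<b b<a+p =
  0<n<p⇒p∤n (ℕₚ.m<n⇒0<n∸m a<b) (ℕₚ.m<n+o⇒m∸n<o b a b<a+p)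
    ∘ subst (+ suc p ∣_) (trans (ℤₚ.m-n≡m⊖n b a) (ℤₚ.⊖-≥ (ℕₚ.<⇒≤ a<b)))

pos-^ : ∀ a k → (+ a) ^ k ≡ + (a ℕ.^ k)
pos-^ a zero    = refl
pos-^ a (suc k) = trans (cong (+ a *_) (pos-^ a k)) (sym (ℤₚ.pos-* a (a ℕ.^ k)))

x-y∣x^k-y^k : ∀ x y k → x - y ∣ x ^ k - y ^ k
x-y∣x^k-y^k x y zero    = divides 0ℤ (ℤₚ.+-inverseʳ 1ℤ)
x-y∣x^k-y^k x y (suc k) =
  subst (x - y ∣_) (sym (split x y (x ^ k) (y ^ k)))
        (∣m∣n⇒∣m+n (∣n⇒∣m*n x (x-y∣x^k-y^k x y k)) (∣m⇒∣m*n (y ^ k) ∣-refl))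
  where
    split : ∀ x y a b → x * a - y * b ≡ x * (a - b) + (x - y) * b
    split = solve-∀

∣x-x%ℕd : ∀ x d .{{_ : NonZero d}} → + d ∣ x - + (x %ℕ d)
∣x-x%ℕd x d = divides (x /ℕ d) (begin
  x - + (x %ℕ d)                             ≡⟨ cong (_- + (x %ℕ d)) (a≡a%ℕn+[a/ℕn]*n x d) ⟩
  + (x %ℕ d) + (x /ℕ d) * + d - + (x %ℕ d)   ≡⟨ cancel (+ (x %ℕ d)) (x /ℕ d * + d) ⟩
  (x /ℕ d) * + d                             ∎)
  where
    open ≡-Reasoning
    cancel : ∀ r y → r + y - r ≡ y
    cancel = solve-∀

∣⇒≡[/ℕ]* : ∀ x d .{{_ : NonZero d}} → + d ∣ x → x ≡ (x /ℕ d) * + d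
∣⇒≡[/ℕ]* x d d∣x = begin
  x                             ≡⟨ a≡a%ℕn+[a/ℕn]*n x d ⟩
  + (x %ℕ d) + (x /ℕ d) * + d   ≡⟨ cong (λ r → + r + (x /ℕ d) * + d) r≡0 ⟩
  0ℤ + (x /ℕ d) * + d           ≡⟨ ℤₚ.+-identityˡ _ ⟩
  (x /ℕ d) * + d                ∎
  where
    open ≡-Reasoning
    d∣r : + d ∣ + (x %ℕ d)
    d∣r = subst (+ d ∣_) (cancel x (+ (x %ℕ d))) (∣m∣n⇒∣m-n d∣x (∣x-x%ℕd x d))
      where
        cancel : ∀ x r → x - (x - r) ≡ r
        cancel = solve-∀
    r≡0 : x %ℕ d ≡ 0
    r≡0 = trans (sym (m<n⇒m%n≡m (n%ℕd<d x d))) (ℕᵈ.n∣m⇒m%n≡0 _ d (∣⇒∣ᵤ d∣r))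

c*c∣[x+c]^[1+k]-x^[1+k]-[1+k]cx^k : ∀ x c k → c * c ∣ (x + c) ^ suc k - x ^ suc k - + suc k * c * x ^ k
c*c∣[x+c]^[1+k]-x^[1+k]-[1+k]cx^k x c zero    = divides 0ℤ (vanish x c)
  where
    vanish : ∀ x c → (x + c) * 1ℤ - x * 1ℤ - 1ℤ * c * 1ℤ ≡ 0ℤ * (c * c)
    vanish = solve-∀
c*c∣[x+c]^[1+k]-x^[1+k]-[1+k]cx^k x c (suc k) =
  subst (c * c ∣_) (sym (step x c ((x + c) ^ suc k) (x ^ k) (+ suc k)))
        (∣m∣n⇒∣m+n (∣n⇒∣m*n (x + c) (c*c∣[x+c]^[1+k]-x^[1+k]-[1+k]cx^k x c k)) (∣m⇒∣m*n _ ∣-refl))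
  where
    step : ∀ x c e a n → (x + c) * e - x * (x * a) - (1ℤ + n) * c * (x * a)
                         ≡ (x + c) * (e - x * a - n * c * a) + c * c * (n * a)
    step = solve-∀

-- Fermat's little theorem

private
  module ℕ-Binomial = Binomial ℕₚ.+-*-commutativeSemiring
  open RawSemiring (CommutativeSemiring.rawSemiring ℕₚ.+-*-commutativeSemiring)
    using (sum) renaming (_×_ to _×ₙ_; _^_ to _^ₙ_)

-- The library's binomial theorem uses the generic power and multiple of a semiring,
-- which agree with ℕ's _^_ and _*_ only propositionally.
^ₙ≡^ : ∀ x n → x ^ₙ n ≡ x ℕ.^ n
^ₙ≡^ x zero    = refl
^ₙ≡^ x (suc n) = cong (x ℕ.*_) (^ₙ≡^ x n)

×ₙ≡* : ∀ n x → n ×ₙ x ≡ n ℕ.* x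
×ₙ≡* zero    x = refl
×ₙ≡* (suc n) x = cong (x ℕ.+_) (×ₙ≡* n x)

sum≡last+multiple : ∀ {d} n (g : Fin (suc n) → ℕ) → (∀ i → toℕ i < n → d ℕᵈ.∣ g i) →
                    ∃ λ k → sum g ≡ g (fromℕ n) ℕ.+ k ℕ.* d
sum≡last+multiple zero g _ = 0 , refl
sum≡last+multiple {d} (suc n) g d∣g with sum≡last+multiple n (g ∘ Fin.suc) (λ i → d∣g (Fin.suc i) ∘ s≤s)
... | k , sum≡ with d∣g Fin.zero (s≤s z≤n)
... | ℕᵈ.divides a g₀≡ = a ℕ.+ k , (begin
  g Fin.zero ℕ.+ sum (g ∘ Fin.suc)  ≡⟨ cong₂ ℕ._+_ g₀≡ sum≡ ⟩
  a ℕ.* d ℕ.+ (l ℕ.+ k ℕ.* d)       ≡⟨ regroup a l k d ⟩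
  l ℕ.+ (a ℕ.+ k) ℕ.* d             ∎)
  where
    open ≡-Reasoning
    l = g (Fin.suc (fromℕ n))
    regroup : ∀ a l k d → a ℕ.* d ℕ.+ (l ℕ.+ k ℕ.* d) ≡ l ℕ.+ (a ℕ.+ k) ℕ.* d
    regroup = ℕ-solve-∀

module _ {m : ℕ} (p-prime : Prime (suc m)) where

  private
    p : ℕ
    p = suc m

  p∤k! : ∀ {k} → k < p → ¬ (p ℕᵈ.∣ k !)
  p∤k! {zero}  _   p∣1 = ¬prime[1] (subst Prime (ℕᵈ.∣1⇒≡1 p∣1) p-prime)
  p∤k! {suc k} k<p p∣k! with euclidsLemma (suc k) (k !) p-prime p∣k!
  ... | inj₁ p∣1+k = ℕₚ.<⇒≱ k<p (ℕᵈ.∣⇒≤ p∣1+k)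
  ... | inj₂ p∣k!  = p∤k! (ℕₚ.<-trans (ℕₚ.n<1+n k) k<p) p∣k!

  p∣pCk : ∀ {k} → 0 < k → k < p → p ℕᵈ.∣ p C k
  p∣pCk {k} 0<k k<p with euclidsLemma (p C k) (k ! ℕ.* (p ℕ.∸ k) !) p-prime (subst (p ℕᵈ.∣_) p!≡ (ℕᵈ.m∣m*n (m !)))
    where
      instance _ = ℕₚ._!*_!≢0 k (p ℕ.∸ k)
      p!≡ : p ! ≡ (p C k) ℕ.* (k ! ℕ.* (p ℕ.∸ k) !)
      p!≡ = trans (sym (m/n*n≡m (k![n∸k]!∣n! (ℕₚ.<⇒≤ k<p))))
                  (cong (ℕ._* (k ! ℕ.* (p ℕ.∸ k) !)) (sym (nCk≡n!/k![n-k]! (ℕₚ.<⇒≤ k<p))))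
  ... | inj₁ p∣pCk = p∣pCk
  ... | inj₂ p∣k!*[p-k]! with euclidsLemma (k !) ((p ℕ.∸ k) !) p-prime p∣k!*[p-k]!
  ...   | inj₁ p∣k!      = contradiction p∣k! (p∤k! k<p)
  ...   | inj₂ p∣[p-k]!  = contradiction p∣[p-k]! (p∤k! (ℕₚ.∸-monoʳ-< 0<k (ℕₚ.<⇒≤ k<p)))

  freshmansDream : ∀ n → ∃ λ k → suc n ℕ.^ p ≡ n ℕ.^ p ℕ.+ 1 ℕ.+ k ℕ.* p
  freshmansDream n with sum≡last+multiple m (term ∘ Fin.suc) middle
    where
      term = ℕ-Binomial.binomialTerm 1 n p
      middle : ∀ i → toℕ i < m → p ℕᵈ.∣ term (Fin.suc i)
      middle i i<m = subst (p ℕᵈ.∣_) (sym (×ₙ≡* (p C suc (toℕ i)) _))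
                       (ℕᵈ.∣m⇒∣m*n _ (p∣pCk (s≤s z≤n) (s≤s i<m)))
  ... | k , sum≡ = k , (begin
    suc n ℕ.^ p                                  ≡⟨ sym (^ₙ≡^ (suc n) p) ⟩
    (1 ℕ.+ n) ^ₙ p                               ≡⟨ ℕ-Binomial.theorem p 1 n ⟩
    term Fin.zero ℕ.+ sum (term ∘ Fin.suc)       ≡⟨ cong₂ ℕ._+_ first sum≡ ⟩
    n ℕ.^ p ℕ.+ (term (fromℕ p) ℕ.+ k ℕ.* p)     ≡⟨ cong (λ t → n ℕ.^ p ℕ.+ (t ℕ.+ k ℕ.* p)) last ⟩
    n ℕ.^ p ℕ.+ (1 ℕ.+ k ℕ.* p)                  ≡⟨ sym (ℕₚ.+-assoc (n ℕ.^ p) 1 (k ℕ.* p)) ⟩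
    n ℕ.^ p ℕ.+ 1 ℕ.+ k ℕ.* p                    ∎)
    where
      open ≡-Reasoning
      term = ℕ-Binomial.binomialTerm 1 n p
      first : term Fin.zero ≡ n ℕ.^ p
      first = begin
        (p C 0) ×ₙ (1 ℕ.* n ^ₙ p)    ≡⟨ ×ₙ≡* (p C 0) _ ⟩
        (p C 0) ℕ.* (1 ℕ.* n ^ₙ p)   ≡⟨ cong₂ ℕ._*_ (trans (nCk≡nC[n∸k] {0} {p} z≤n) (nCn≡1 p))
                                                     (trans (ℕₚ.*-identityˡ _) (^ₙ≡^ n p)) ⟩
        1 ℕ.* n ℕ.^ p                ≡⟨ ℕₚ.*-identityˡ _ ⟩
        n ℕ.^ p                      ∎
      last : term (fromℕ p) ≡ 1
      last = begin
        term (fromℕ p)                                  ≡⟨ cong (λ j → (p C j) ×ₙ (1 ^ₙ j ℕ.* n ^ₙ (p ℕ.∸ j))) (toℕ-fromℕ p) ⟩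
        (p C p) ×ₙ (1 ^ₙ p ℕ.* n ^ₙ (p ℕ.∸ p))          ≡⟨ ×ₙ≡* (p C p) _ ⟩
        (p C p) ℕ.* (1 ^ₙ p ℕ.* n ^ₙ (p ℕ.∸ p))         ≡⟨ cong₂ ℕ._*_ (nCn≡1 p) (cong₂ ℕ._*_ (trans (^ₙ≡^ 1 p) (ℕₚ.^-zeroˡ p))
                                                                                         (cong (n ^ₙ_) (ℕₚ.n∸n≡0 p))) ⟩
        1                                               ∎

  p∣n^p-n : ∀ n → + p ∣ (+ n) ^ p - + n
  p∣n^p-n zero    = subst (λ z → + p ∣ z - 0ℤ) (sym (ℤₚ.*-zeroˡ (0ℤ ^ m))) (divides 0ℤ refl)
  p∣n^p-n (suc n) with freshmansDream n
  ... | k , dream = subst (+ p ∣_) (sym (begin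
    (+ suc n) ^ p - + suc n                          ≡⟨ cong (_- + suc n) (pos-^ (suc n) p) ⟩
    + (suc n ℕ.^ p) - + suc n                        ≡⟨ cong (λ z → + z - + suc n) dream ⟩
    + (n ℕ.^ p ℕ.+ 1 ℕ.+ k ℕ.* p) - + suc n          ≡⟨ cong (_- + suc n) (ℤₚ.pos-+ (n ℕ.^ p ℕ.+ 1) (k ℕ.* p)) ⟩
    + (n ℕ.^ p ℕ.+ 1) + + (k ℕ.* p) - + suc n        ≡⟨ cong₂ (λ a b → a + b - + suc n) (ℤₚ.pos-+ (n ℕ.^ p) 1) (ℤₚ.pos-* k p) ⟩
    + (n ℕ.^ p) + 1ℤ + + k * + p - (1ℤ + + n)        ≡⟨ regroup (+ (n ℕ.^ p)) (+ k) (+ n) (+ p) ⟩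
    (+ (n ℕ.^ p) - + n) + + k * + p                  ≡⟨ cong (λ z → z - + n + + k * + p) (sym (pos-^ n p)) ⟩
    (+ n) ^ p - + n + + k * + p                      ∎))
    (∣m∣n⇒∣m+n (p∣n^p-n n) (divides (+ k) refl))
    where
      open ≡-Reasoning
      regroup : ∀ a k n p → a + 1ℤ + k * p - (1ℤ + n) ≡ (a - n) + k * p
      regroup = solve-∀

  p∣x^p-x : ∀ x → + p ∣ x ^ p - x
  p∣x^p-x x = subst (+ p ∣_) (regroup (x ^ p) x (r ^ p) r)
    (∣m∣n⇒∣m+n (∣m∣n⇒∣m+n (∣-trans x≡r (x-y∣x^k-y^k x r p)) (p∣n^p-n (x %ℕ p))) (∣m⇒∣-m x≡r))
    where
      r = + (x %ℕ p)
      x≡r : + p ∣ x - r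
      x≡r = ∣x-x%ℕd x p
      regroup : ∀ a x b r → (a - b) + (b - r) + - (x - r) ≡ a - x
      regroup = solve-∀

  fermatsLittleTheorem : ∀ x → ¬ (+ p ∣ x) → + p ∣ x ^ m - 1ℤ
  fermatsLittleTheorem x p∤x = [ flip contradiction p∤x , id ]′ (euclidsLemmaℤ p-prime x (x ^ m - 1ℤ) p∣x[x^m-1])
    where
      factor : ∀ x a → x * a - x ≡ x * (a - 1ℤ)
      factor = solve-∀
      p∣x[x^m-1] : + p ∣ x * (x ^ m - 1ℤ)
      p∣x[x^m-1] = subst (+ p ∣_) (factor x (x ^ m)) (p∣x^p-x x)

-- Fermat quotients

module _ {m : ℕ} (p-prime : Prime (suc (suc m))) where

  private
    p : ℕ
    p = suc (suc m)

  fermatQuotient-∤ : ∀ {x} → ¬ (+ p ∣ x) → fermatQuotient p x ≡ ((x ^ suc m - 1ℤ) /ℕ p) %ℕ p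
  fermatQuotient-∤ {x} p∤x =
    cong (λ b → if b then 0 else ((x ^ suc m - 1ℤ) /ℕ p) %ℕ p) (dec-false (p ℕᵈ.∣? ℤ.∣ x ∣) (p∤x ∘ ∣ᵤ⇒∣))

  p²∣p*q-[x^[p-1]-1] : ∀ {x} → ¬ (+ p ∣ x) → + p * + p ∣ + p * + fermatQuotient p x - (x ^ suc m - 1ℤ)
  p²∣p*q-[x^[p-1]-1] {x} p∤x = subst (+ p * + p ∣_) (sym (begin
    + p * + fermatQuotient p x - X    ≡⟨ cong₂ (λ q y → + p * + q - y) (fermatQuotient-∤ p∤x) (∣⇒≡[/ℕ]* X p p∣X) ⟩
    + p * + (Q %ℕ p) - Q * + p        ≡⟨ factor (+ p) (+ (Q %ℕ p)) Q ⟩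
    + p * - (Q - + (Q %ℕ p))          ∎))
    (*-monoʳ-∣ (+ p) (∣m⇒∣-m (∣x-x%ℕd Q p)))
    where
      open ≡-Reasoning
      X = x ^ suc m - 1ℤ
      p∣X = fermatsLittleTheorem p-prime x p∤x
      Q = X /ℕ p
      factor : ∀ p r Q → p * r - Q * p ≡ p * - (Q - r)
      factor = solve-∀

  fermatQuotient-shift : ∀ {x} → ¬ (+ p ∣ x) → + p ∣ x * (+ fermatQuotient p (x + + p) - + fermatQuotient p x) + 1ℤ
  fermatQuotient-shift {x} p∤x = subst (+ p ∣_) (regroup x t n a)
    (∣m∣n⇒∣m+n (∣n⇒∣m*n x p∣t-na) (∣m∣n⇒∣m-n (∣m⇒∣m*n (x * a) ∣-refl) (fermatsLittleTheorem p-prime x p∤x)))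
    where
      q  = + fermatQuotient p x
      q' = + fermatQuotient p (x + + p)
      t  = q' - q
      n  = + suc m
      a  = x ^ m
      p∤x+p : ¬ (+ p ∣ x + + p)
      p∤x+p p∣x+p = p∤x (∣m+n∣n⇒∣m p∣x+p ∣-refl)
      p*p∣p[t-na] : + p * + p ∣ + p * (t - n * a)
      p*p∣p[t-na] = subst (+ p * + p ∣_) (telescope (+ p) q' q ((x + + p) ^ suc m) (x * a) n a)
        (∣m∣n⇒∣m+n (∣m∣n⇒∣m-n (p²∣p*q-[x^[p-1]-1] p∤x+p) (p²∣p*q-[x^[p-1]-1] p∤x))
                   (c*c∣[x+c]^[1+k]-x^[1+k]-[1+k]cx^k x (+ p) m))
        where
          telescope : ∀ P q' q e' e n a → (P * q' - (e' - 1ℤ)) - (P * q - (e - 1ℤ)) + (e' - e - n * P * a)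
                                          ≡ P * ((q' - q) - n * a)
          telescope = solve-∀
      p∣t-na : + p ∣ t - n * a
      p∣t-na = *-cancelˡ-∣ (+ p) p*p∣p[t-na]
      regroup : ∀ x t n a → x * (t - n * a) + ((1ℤ + n) * (x * a) - (x * a - 1ℤ)) ≡ x * t + 1ℤ
      regroup = solve-∀

-- Polynomials modulo a prime

-- Polynomial n f: f is an integer polynomial function with at most n coefficients (in Horner form).
Polynomial : ℕ → (ℤ → ℤ) → Set
Polynomial zero    f = ∀ x → f x ≡ 0ℤ
Polynomial (suc n) f = Σ ℤ λ a → Σ (ℤ → ℤ) λ g → Polynomial n g × (∀ x → f x ≡ a + x * g x)

Polynomial-resp : ∀ {n f g} → (∀ x → f x ≡ g x) → Polynomial n f → Polynomial n g
Polynomial-resp {zero}  f≗g f≗0 x = trans (sym (f≗g x)) (f≗0 x)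
Polynomial-resp {suc n} f≗g (a , h , poly-h , f≗) = a , h , poly-h , λ x → trans (sym (f≗g x)) (f≗ x)

Polynomial-const : ∀ a → Polynomial 1 (λ _ → a)
Polynomial-const a = a , (λ _ → 0ℤ) , (λ _ → refl) , λ x → sym (trans (cong (λ y → a + y) (ℤₚ.*-zeroʳ x)) (ℤₚ.+-identityʳ a))

Polynomial-lift : ∀ {n f} → Polynomial n f → Polynomial (suc n) f
Polynomial-lift {zero}  f≗0 = Polynomial-resp (λ x → sym (f≗0 x)) (Polynomial-const 0ℤ)
Polynomial-lift {suc n} (a , g , poly-g , f≗) = a , g , Polynomial-lift poly-g , f≗

Polynomial-+ : ∀ {n f g} → Polynomial n f → Polynomial n g → Polynomial n (λ x → f x + g x)
Polynomial-+ {zero}  f≗0 g≗0 x = cong₂ _+_ (f≗0 x) (g≗0 x)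
Polynomial-+ {suc n} (a , f' , poly-f' , f≗) (b , g' , poly-g' , g≗) =
  a + b , _ , Polynomial-+ poly-f' poly-g' ,
  λ x → trans (cong₂ _+_ (f≗ x) (g≗ x)) (shuffle a b x (f' x) (g' x))
  where
    shuffle : ∀ a b x u v → a + x * u + (b + x * v) ≡ a + b + x * (u + v)
    shuffle = solve-∀

Polynomial-* : ∀ {n f} c → Polynomial n f → Polynomial n (λ x → c * f x)
Polynomial-* {zero}  c f≗0 x = trans (cong (c *_) (f≗0 x)) (ℤₚ.*-zeroʳ c)
Polynomial-* {suc n} c (a , g , poly-g , f≗) =
  c * a , _ , Polynomial-* c poly-g , λ x → trans (cong (c *_) (f≗ x)) (distrib c a x (g x))
  where
    distrib : ∀ c a x u → c * (a + x * u) ≡ c * a + x * (c * u)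
    distrib = solve-∀

Polynomial-x+c* : ∀ {n f} c → Polynomial n f → Polynomial (suc n) (λ x → (x + c) * f x)
Polynomial-x+c* c poly-f =
  Polynomial-resp (λ x → expand x c _)
    (Polynomial-+ (Polynomial-lift (Polynomial-* c poly-f)) (0ℤ , _ , poly-f , λ _ → refl))
  where
    expand : ∀ x c u → c * u + (0ℤ + x * u) ≡ (x + c) * u
    expand = solve-∀

Polynomial-divide : ∀ {n f} → Polynomial (suc n) f → ∀ r →
                    Σ (ℤ → ℤ) λ g → Polynomial n g × ∀ x → f x ≡ (x - r) * g x + f r
Polynomial-divide {zero} {f} (a , g , g≗0 , f≗) r = (λ _ → 0ℤ) , (λ _ → refl) , λ x → begin
  f x                       ≡⟨ trans (f≗ x) (cong (λ y → a + x * y) (g≗0 x)) ⟩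
  a + x * 0ℤ                ≡⟨ drop x r a ⟩
  (x - r) * 0ℤ + (a + r * 0ℤ) ≡⟨ cong (λ y → (x - r) * 0ℤ + (a + r * y)) (sym (g≗0 r)) ⟩
  (x - r) * 0ℤ + (a + r * g r) ≡⟨ cong (_+_ ((x - r) * 0ℤ)) (sym (f≗ r)) ⟩
  (x - r) * 0ℤ + f r        ∎
  where
    open ≡-Reasoning
    drop : ∀ x r a → a + x * 0ℤ ≡ (x - r) * 0ℤ + (a + r * 0ℤ)
    drop = solve-∀
Polynomial-divide {suc n} {f} (a , h , poly-h , f≗) r with Polynomial-divide poly-h r
... | k , poly-k , h≗ =
  (λ x → h r + x * k x) , (h r , k , poly-k , λ _ → refl) ,
  λ x → begin
    f x                               ≡⟨ f≗ x ⟩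
    a + x * h x                       ≡⟨ cong (λ y → a + x * y) (h≗ x) ⟩
    a + x * ((x - r) * k x + h r)     ≡⟨ regroup a x r (k x) (h r) ⟩
    (x - r) * (h r + x * k x) + (a + r * h r) ≡⟨ cong (_+_ ((x - r) * (h r + x * k x))) (sym (f≗ r)) ⟩
    (x - r) * (h r + x * k x) + f r   ∎
  where
    open ≡-Reasoning
    regroup : ∀ a x r u v → a + x * ((x - r) * u + v) ≡ (x - r) * (v + x * u) + (a + r * v)
    regroup = solve-∀

linearProduct : ℕ → (ℕ → ℤ) → ℤ → ℤ
linearProduct zero    a x = 1ℤ
linearProduct (suc k) a x = (x + a 0) * linearProduct k (a ∘ suc) x

-- Σ_{i<k} d i ∏_{j≠i} (x + a j), i.e. Σ_{i<k} d i / (x + a i) times linearProduct k a x.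
partialFractionNumerator : (k : ℕ) → (Fin k → ℤ) → (ℕ → ℤ) → ℤ → ℤ
partialFractionNumerator zero    d a x = 0ℤ
partialFractionNumerator (suc k) d a x =
  d Fin.zero * linearProduct k (a ∘ suc) x + (x + a 0) * partialFractionNumerator k (d ∘ Fin.suc) (a ∘ suc) x

Polynomial-linearProduct : ∀ k a → Polynomial (suc k) (linearProduct k a)
Polynomial-linearProduct zero    a = Polynomial-const 1ℤ
Polynomial-linearProduct (suc k) a = Polynomial-x+c* (a 0) (Polynomial-linearProduct k (a ∘ suc))

Polynomial-partialFractionNumerator : ∀ k d a → Polynomial k (partialFractionNumerator k d a)
Polynomial-partialFractionNumerator zero    d a x = refl
Polynomial-partialFractionNumerator (suc k) d a =
  Polynomial-+ (Polynomial-* (d Fin.zero) (Polynomial-linearProduct k (a ∘ suc)))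
               (Polynomial-x+c* (a 0) (Polynomial-partialFractionNumerator k (d ∘ Fin.suc) (a ∘ suc)))

module _ {p : ℕ} (p-prime : Prime p) where

  Polynomial-roots : ∀ {n f} → Polynomial n f → (r : ℕ → ℤ) →
                     (∀ {i j} → i < j → j < n → ¬ (+ p ∣ r j - r i)) →
                     (∀ {i} → i < n → + p ∣ f (r i)) →
                     ∀ x → + p ∣ f x
  Polynomial-roots {zero} f≗0 r _ _ x = subst (+ p ∣_) (sym (f≗0 x)) (divides 0ℤ refl)
  Polynomial-roots {suc n} {f} poly-f r distinct roots x =
    subst (+ p ∣_) (sym (f≗ x)) (∣m∣n⇒∣m+n (∣n⇒∣m*n (x - r n) (g-roots x)) (roots (ℕₚ.n<1+n n)))
    where
      divided = Polynomial-divide poly-f (r n)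
      g = proj₁ divided
      f≗ = proj₂ (proj₂ divided)
      g-root : ∀ {i} → i < n → + p ∣ g (r i)
      g-root {i} i<n with euclidsLemmaℤ p-prime (r i - r n) (g (r i))
        (∣m+n∣n⇒∣m (subst (+ p ∣_) (f≗ (r i)) (roots (ℕₚ.m<n⇒m<1+n i<n))) (roots (ℕₚ.n<1+n n)))
      ... | inj₂ p∣g = p∣g
      ... | inj₁ p∣ri-rn = contradiction (subst (+ p ∣_) (neg-minus (r i) (r n)) (∣m⇒∣-m p∣ri-rn)) (distinct i<n (ℕₚ.n<1+n n))
        where
          neg-minus : ∀ a b → - (a - b) ≡ b - a
          neg-minus = solve-∀
      g-roots : ∀ x → + p ∣ g x
      g-roots = Polynomial-roots (proj₁ (proj₂ divided)) r (λ i<j j<n → distinct i<j (ℕₚ.m<n⇒m<1+n j<n)) g-root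

  -- If t j ≡ -1/(x + a j) mod p for all j < k, clearing denominators in Σ d i t i gives minus the numerator.
  partialFraction : ∀ k (d : Fin k → ℤ) (a t : ℕ → ℤ) x → (∀ {j} → j < k → + p ∣ (x + a j) * t j + 1ℤ) →
                    + p ∣ linearProduct k a x * sumFin k (λ i → d i * t (toℕ i)) + partialFractionNumerator k d a x
  partialFraction zero d a t x _ = divides 0ℤ refl
  partialFraction (suc k) d a t x inverse =
    subst (+ p ∣_) (sym (regroup (x + a 0) W (d Fin.zero) (t 0) Σt F))
      (∣m∣n⇒∣m+n (∣n⇒∣m*n (d Fin.zero * W) (inverse (s≤s z≤n)))
                 (∣n⇒∣m*n (x + a 0) (partialFraction k (d ∘ Fin.suc) (a ∘ suc) (t ∘ suc) x (λ j<k → inverse (s≤s j<k)))))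
    where
      W  = linearProduct k (a ∘ suc) x
      Σt = sumFin k (λ i → d (Fin.suc i) * t (suc (toℕ i)))
      F  = partialFractionNumerator k (d ∘ Fin.suc) (a ∘ suc) x
      regroup : ∀ y W d₀ t₀ Σt F → y * W * (d₀ * t₀ + Σt) + (d₀ * W + y * F)
                                   ≡ d₀ * W * (y * t₀ + 1ℤ) + y * (W * Σt + F)
      regroup = solve-∀

  linearProduct-∤ : 1 < p → ∀ k a x → (∀ {j} → j < k → ¬ (+ p ∣ x + a j)) → ¬ (+ p ∣ linearProduct k a x)
  linearProduct-∤ 1<p zero a x _ = 0<n<p⇒p∤n (s≤s z≤n) 1<p
  linearProduct-∤ 1<p (suc k) a x p∤factor p∣prod with euclidsLemmaℤ p-prime _ _ p∣prod
  ... | inj₁ p∣x+a₀ = p∤factor (s≤s z≤n) p∣x+a₀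
  ... | inj₂ p∣rest = linearProduct-∤ 1<p k (a ∘ suc) x (λ j<k → p∤factor (s≤s j<k)) p∣rest

-- Windows avoiding a residue class

-- Windows [i, i + L] that would reach e are moved just past it, by min e L + 1.
module StartingPoints (L : ℕ) {e p : ℕ} (2L+1<p : L ℕ.+ suc L < p) (e<p : e < p) where

  private
    g : ℕ
    g = e ℕ.⊓ L

    startBy : ∀ i → Dec (i ℕ.+ L < e) → ℕ
    startBy i (yes _) = i
    startBy i (no _)  = i ℕ.+ suc g

  start : ℕ → ℕ
  start i = startBy i (i ℕ.+ L ℕ.<? e)

  start-≤ : ∀ {i} → i ≤ L → start i ≤ L ℕ.+ suc L
  start-≤ {i} i≤L with i ℕ.+ L ℕ.<? e
  ... | yes _ = ℕₚ.≤-trans i≤L (ℕₚ.m≤m+n L (suc L))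
  ... | no _  = ℕₚ.+-mono-≤ i≤L (s≤s (ℕₚ.m⊓n≤n e L))

  start-strictMono : ∀ {i j} → i < j → start i < start j
  start-strictMono {i} {j} i<j with i ℕ.+ L ℕ.<? e | j ℕ.+ L ℕ.<? e
  ... | yes _   | yes _    = i<j
  ... | yes _   | no _     = ℕₚ.<-≤-trans i<j (ℕₚ.m≤m+n j (suc g))
  ... | no i+L≮e | yes j+L<e = contradiction (ℕₚ.<-trans (ℕₚ.+-monoˡ-< L i<j) j+L<e) i+L≮e
  ... | no _    | no _     = ℕₚ.+-monoˡ-< (suc g) i<j

  start-window : ∀ {i j} → i ≤ L → j ≤ L → start i ℕ.+ j < e ⊎ (e < start i ℕ.+ j × start i ℕ.+ j < e ℕ.+ p)
  start-window {i} {j} i≤L j≤L with i ℕ.+ L ℕ.<? e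
  ... | yes i+L<e = inj₁ (ℕₚ.≤-<-trans (ℕₚ.+-monoʳ-≤ i j≤L) i+L<e)
  ... | no i+L≮e  = inj₂ (above , below)
    where
      e≤i+g : e ≤ i ℕ.+ g
      e≤i+g with ℕₚ.⊓-sel e L
      ... | inj₁ g≡e = subst (λ g → e ≤ i ℕ.+ g) (sym g≡e) (ℕₚ.m≤n+m e i)
      ... | inj₂ g≡L = subst (λ g → e ≤ i ℕ.+ g) (sym g≡L) (ℕₚ.≮⇒≥ i+L≮e)
      above : e < i ℕ.+ suc g ℕ.+ j
      above = ℕₚ.≤-trans (s≤s e≤i+g) (ℕₚ.≤-trans (ℕₚ.≤-reflexive (sym (ℕₚ.+-suc i g))) (ℕₚ.m≤m+n _ j))
      g+2L<e+p : g ℕ.+ (L ℕ.+ suc L) < e ℕ.+ p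
      g+2L<e+p = ℕₚ.+-mono-≤-< (ℕₚ.m⊓n≤m e L) 2L+1<p
      below : i ℕ.+ suc g ℕ.+ j < e ℕ.+ p
      below = ℕₚ.≤-<-trans (ℕₚ.+-mono-≤ (ℕₚ.+-monoˡ-≤ (suc g) i≤L) j≤L)
                (subst (_< e ℕ.+ p) (shuffle L g) g+2L<e+p)
        where
          shuffle : ∀ L g → g ℕ.+ (L ℕ.+ suc L) ≡ L ℕ.+ suc g ℕ.+ L
          shuffle = ℕ-solve-∀

-- Linear recurrences

sumFin-cong : ∀ L {f g : Fin L → ℤ} → (∀ i → f i ≡ g i) → sumFin L f ≡ sumFin L g
sumFin-cong zero    _   = refl
sumFin-cong (suc L) f≗g = cong₂ _+_ (f≗g Fin.zero) (sumFin-cong L (f≗g ∘ Fin.suc))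

sumFin-*-- : ∀ L (c f g : Fin L → ℤ) →
             sumFin L (λ i → c i * (f i - g i)) ≡ sumFin L (λ i → c i * f i) - sumFin L (λ i → c i * g i)
sumFin-*-- zero    c f g = refl
sumFin-*-- (suc L) c f g =
  trans (cong (_+_ (c Fin.zero * (f Fin.zero - g Fin.zero))) (sumFin-*-- L (c ∘ Fin.suc) (f ∘ Fin.suc) (g ∘ Fin.suc)))
        (regroup (c Fin.zero) (f Fin.zero) (g Fin.zero) (sumFin L (λ i → c (Fin.suc i) * f (Fin.suc i)))
                 (sumFin L (λ i → c (Fin.suc i) * g (Fin.suc i))))
  where
    regroup : ∀ c a b A B → c * (a - b) + (A - B) ≡ c * a + A - (c * b + B)
    regroup = solve-∀

RecurrenceAt : ℕ → ∀ {L} → (Fin L → ℤ) → (ℕ → ℤ) → ℕ → Set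
RecurrenceAt p {L} c s u = + p ∣ s (u ℕ.+ L) - sumFin L (λ i → c i * s (u ℕ.+ toℕ i))

RecurrenceAt-difference : ∀ {p L} (c : Fin L → ℤ) s k {u} →
                          RecurrenceAt p c s (u ℕ.+ k) → RecurrenceAt p c s u →
                          RecurrenceAt p c (λ n → s (n ℕ.+ k) - s n) u
RecurrenceAt-difference {p} {L} c s k {u} at-u+k at-u =
  subst (+ p ∣_) (begin
    (s (u ℕ.+ k ℕ.+ L) - Σc (λ i → s (u ℕ.+ k ℕ.+ toℕ i))) - (s (u ℕ.+ L) - Σc (λ i → s (u ℕ.+ toℕ i)))
      ≡⟨ cong₂ (λ a b → (s a - b) - (s (u ℕ.+ L) - Σc (λ i → s (u ℕ.+ toℕ i)))) (swap u k L)
               (sumFin-cong L (λ i → cong (λ n → c i * s n) (swap u k (toℕ i)))) ⟩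
    (s (u ℕ.+ L ℕ.+ k) - Σc (λ i → s (u ℕ.+ toℕ i ℕ.+ k))) - (s (u ℕ.+ L) - Σc (λ i → s (u ℕ.+ toℕ i)))
      ≡⟨ regroup (s (u ℕ.+ L ℕ.+ k)) (Σc (λ i → s (u ℕ.+ toℕ i ℕ.+ k))) (s (u ℕ.+ L)) (Σc (λ i → s (u ℕ.+ toℕ i))) ⟩
    (s (u ℕ.+ L ℕ.+ k) - s (u ℕ.+ L)) - (Σc (λ i → s (u ℕ.+ toℕ i ℕ.+ k)) - Σc (λ i → s (u ℕ.+ toℕ i)))
      ≡⟨ cong (_-_ (s (u ℕ.+ L ℕ.+ k) - s (u ℕ.+ L))) (sym (sumFin-*-- L c _ _)) ⟩
    (s (u ℕ.+ L ℕ.+ k) - s (u ℕ.+ L)) - sumFin L (λ i → c i * (s (u ℕ.+ toℕ i ℕ.+ k) - s (u ℕ.+ toℕ i))) ∎)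
  (∣m∣n⇒∣m-n at-u+k at-u)
  where
    open ≡-Reasoning
    Σc : (Fin L → ℤ) → ℤ
    Σc f = sumFin L (λ i → c i * f i)
    swap : ∀ a b c → a ℕ.+ b ℕ.+ c ≡ a ℕ.+ c ℕ.+ b
    swap = ℕ-solve-∀
    regroup : ∀ a A b B → (a - A) - (b - B) ≡ (a - b) - (A - B)
    regroup = solve-∀

-- Linear complexity of Fermat quotients

module _ {m : ℕ} (p-prime : Prime (suc (suc m))) (M : ℤ) where

  private
    p : ℕ
    p = suc (suc m)

    v : ℕ → ℤ
    v u = M + + suc u

    s : ℕ → ℤ
    s u = + fermatQuotient p (v u)

    t : ℕ → ℤ
    t u = s (u ℕ.+ p) - s u

    v-+ : ∀ u k → v (u ℕ.+ k) ≡ v u + + k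
    v-+ u k = trans (cong (_+_ M) (ℤₚ.pos-+ (suc u) k)) (sym (ℤₚ.+-assoc M (+ suc u) (+ k)))

    v-v : ∀ a b → v b - v a ≡ + b - + a
    v-v a b = cancel M (+ a) (+ b)
      where
        cancel : ∀ M a b → M + (1ℤ + b) - (M + (1ℤ + a)) ≡ b - a
        cancel = solve-∀

    t-inverse : ∀ {u} → ¬ (+ p ∣ v u) → + p ∣ v u * t u + 1ℤ
    t-inverse {u} p∤v = subst (λ y → + p ∣ v u * (+ fermatQuotient p y - s u) + 1ℤ) (sym (v-+ u p))
                              (fermatQuotient-shift p-prime p∤v)

    pole : ℕ
    pole = (- (M + 1ℤ)) %ℕ p

    pole<p : pole < p
    pole<p = n%ℕd<d (- (M + 1ℤ)) p

    p∣v[pole] : + p ∣ v pole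
    p∣v[pole] = subst (+ p ∣_) (negate M (+ pole)) (∣m⇒∣-m (∣x-x%ℕd (- (M + 1ℤ)) p))
      where
        negate : ∀ M r → - (- (M + 1ℤ) - r) ≡ M + (1ℤ + r)
        negate = solve-∀

    p∤v : ∀ {k} → k < pole ⊎ (pole < k × k < pole ℕ.+ p) → ¬ (+ p ∣ v k)
    p∤v {k} (inj₁ k<pole) p∣v[k] =
      p∤b-a k<pole (ℕₚ.<-≤-trans pole<p (ℕₚ.m≤n+m p k)) (subst (+ p ∣_) (v-v k pole) (∣m∣n⇒∣m-n p∣v[pole] p∣v[k]))
    p∤v {k} (inj₂ (pole<k , k<pole+p)) p∣v[k] =
      p∤b-a pole<k k<pole+p (subst (+ p ∣_) (v-v pole k) (∣m∣n⇒∣m-n p∣v[k] p∣v[pole]))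

  module _ {N L : ℕ} (c : Fin L → ℤ) (rec : ∀ u → u ℕ.+ L < N → s (u ℕ.+ L) ≡[mod p ] sumFin L (λ i → c i * s (u ℕ.+ toℕ i)))
           (2L+1<p : L ℕ.+ suc L < p) (3L+1+p<N : L ℕ.+ suc L ℕ.+ L ℕ.+ p < N) where

    private
      t-recurrence : ∀ {u} → u ℕ.+ L ℕ.+ p < N → RecurrenceAt p c t u
      t-recurrence {u} u+L+p<N =
        RecurrenceAt-difference c s p (∣ᵤ⇒∣ (rec (u ℕ.+ p) (subst (_< N) (swap u L p) u+L+p<N)))
                                      (∣ᵤ⇒∣ (rec u (ℕₚ.≤-<-trans (ℕₚ.m≤m+n (u ℕ.+ L) p) u+L+p<N)))
        where
          swap : ∀ a b c → a ℕ.+ b ℕ.+ c ≡ a ℕ.+ c ℕ.+ b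
          swap = ℕ-solve-∀

      -- Index 0 stands for the term t (u + L) of the recurrence, index j + 1 for t (u + j).
      d : Fin (suc L) → ℤ
      d = - 1ℤ ∷ c

      a : ℕ → ℤ
      a zero    = + L
      a (suc j) = + j

      F : ℤ → ℤ
      F = partialFractionNumerator (suc L) d a

      F-root : ∀ {u} → (∀ {j} → j ≤ L → ¬ (+ p ∣ v (u ℕ.+ j))) → u ℕ.+ L ℕ.+ p < N → + p ∣ F (v u)
      F-root {u} p∤v[u+j] u+L+p<N = subst (+ p ∣_) (cancel W Σt (F (v u))) (∣m∣n⇒∣m-n cleared (∣n⇒∣m*n W p∣Σt))
        where
          t′ : ℕ → ℤ
          t′ zero    = t (u ℕ.+ L)
          t′ (suc j) = t (u ℕ.+ j)
          inverse : ∀ {j} → j < suc L → + p ∣ (v u + a j) * t′ j + 1ℤ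
          inverse {zero}  _         = subst (λ y → + p ∣ y * t (u ℕ.+ L) + 1ℤ) (v-+ u L) (t-inverse (p∤v[u+j] ℕₚ.≤-refl))
          inverse {suc j} (s≤s j<L) = subst (λ y → + p ∣ y * t (u ℕ.+ j) + 1ℤ) (v-+ u j) (t-inverse (p∤v[u+j] (ℕₚ.<⇒≤ j<L)))
          W  = linearProduct (suc L) a (v u)
          Σt = sumFin (suc L) (λ i → d i * t′ (toℕ i))
          cleared : + p ∣ W * Σt + F (v u)
          cleared = partialFraction p-prime (suc L) d a t′ (v u) inverse
          p∣Σt : + p ∣ Σt
          p∣Σt = subst (+ p ∣_) (negate (t (u ℕ.+ L)) (sumFin L (λ i → c i * t (u ℕ.+ toℕ i)))) (∣m⇒∣-m (t-recurrence u+L+p<N))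
            where
              negate : ∀ x y → - (x - y) ≡ - 1ℤ * x + y
              negate = solve-∀
          cancel : ∀ w σ f → w * σ + f - w * σ ≡ f
          cancel = solve-∀

      open StartingPoints L 2L+1<p pole<p

      F-vanishes : ∀ x → + p ∣ F x
      F-vanishes = Polynomial-roots p-prime (Polynomial-partialFractionNumerator (suc L) d a) (v ∘ start) distinct root
        where
          distinct : ∀ {i j} → i < j → j < suc L → ¬ (+ p ∣ v (start j) - v (start i))
          distinct {i} {j} i<j (s≤s j≤L) =
            p∤b-a (start-strictMono i<j) (ℕₚ.<-≤-trans (ℕₚ.≤-<-trans (start-≤ j≤L) 2L+1<p) (ℕₚ.m≤n+m p (start i)))
              ∘ subst (+ p ∣_) (v-v (start i) (start j))
          root : ∀ {i} → i < suc L → + p ∣ F (v (start i))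
          root {i} (s≤s i≤L) = F-root (λ j≤L → p∤v (start-window i≤L j≤L))
            (ℕₚ.≤-<-trans (ℕₚ.+-monoˡ-≤ p (ℕₚ.+-monoˡ-≤ L (start-≤ i≤L))) 3L+1+p<N)

    p∣∏[-L+j] : + p ∣ linearProduct L +_ (- + L)
    p∣∏[-L+j] = subst (+ p ∣_) (evaluate (+ L) (linearProduct L +_ (- + L)) (partialFractionNumerator L c +_ (- + L)))
                      (∣m⇒∣-m (F-vanishes (- + L)))
      where
        evaluate : ∀ l W S → - (- 1ℤ * W + (- l + l) * S) ≡ W
        evaluate = solve-∀

  noShortRecurrence : ∀ {N L} → HasLinRec p N s L → L ℕ.+ suc L < p → L ℕ.+ suc L ℕ.+ L ℕ.+ p < N → ⊥
  noShortRecurrence {L = L} (c , rec) 2L+1<p 3L+1+p<N =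
    linearProduct-∤ p-prime (s≤s (s≤s z≤n)) L +_ (- + L) p∤-L+j (p∣∏[-L+j] c rec 2L+1<p 3L+1+p<N)
    where
      p∤-L+j : ∀ {j} → j < L → ¬ (+ p ∣ - + L + + j)
      p∤-L+j {j} j<L = p∤b-a {p} {j} {L} j<L (ℕₚ.<-≤-trans L<p (ℕₚ.m≤n+m p j)) ∘ subst (+ p ∣_) (negate (+ L) (+ j)) ∘ ∣m⇒∣-m
        where
          L<p : L < p
          L<p = ℕₚ.≤-<-trans (ℕₚ.m≤m+n L (suc L)) 2L+1<p
          negate : ∀ l j → - (- l + j) ≡ l - j
          negate = solve-∀

+a-+b≤+c : ∀ {a b c} → a ≤ c ℕ.+ b → + a - + b ℤ.≤ + c
+a-+b≤+c {a} {b} {c} a≤c+b =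
  subst (+ a - + b ℤ.≤_) (trans (cong (_- + b) (ℤₚ.pos-+ c b)) (cancel (+ c) (+ b))) (ℤₚ.+-monoˡ-≤ (- + b) (ℤ.+≤+ a≤c+b))
  where
    cancel : ∀ c b → c + b - b ≡ c
    cancel = solve-∀

p-1≤2L : ∀ {p} L → p ≤ L ℕ.+ suc L → + p - + 1 ℤ.≤ + 2 * + L
p-1≤2L {p} L p≤2L+1 = subst (+ p - + 1 ℤ.≤_) (ℤₚ.pos-* 2 L) (+a-+b≤+c (subst (p ≤_) (double L) p≤2L+1))
  where
    double : ∀ L → L ℕ.+ suc L ≡ 2 ℕ.* L ℕ.+ 1
    double = ℕ-solve-∀

N-p-1≤3L : ∀ {N} p L → N ≤ L ℕ.+ suc L ℕ.+ L ℕ.+ p → + N - + p - + 1 ℤ.≤ + 3 * + L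
N-p-1≤3L {N} p L N≤3L+1+p = subst₂ ℤ._≤_ (sym (regroup (+ N) (+ p))) (ℤₚ.pos-* 3 L)
                                        (+a-+b≤+c (subst (N ≤_) (triple L p) N≤3L+1+p))
  where
    triple : ∀ L p → L ℕ.+ suc L ℕ.+ L ℕ.+ p ≡ 3 ℕ.* L ℕ.+ suc p
    triple = ℕ-solve-∀
    regroup : ∀ n p → n - p - 1ℤ ≡ n - (1ℤ + p)
    regroup = solve-∀

theorem14 : (p : ℕ) → .{{_ : NonZero p}} → Prime p →
    (M : ℤ) → (N : ℕ) → p ℕ.* p > N → N ≥ 1 →
    (L : ℕ) →
    IsLinearComplexity p N (λ u → + fermatQuotient p (M ℤ.+ + (suc u))) L →
    ((+ p ℤ.- + 1) ℤ.≤ + 2 ℤ.* + L) ⊎ ((+ N ℤ.- + p ℤ.- + 1) ℤ.≤ + 3 ℤ.* + L)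
theorem14 (suc zero) p-prime _ _ _ _ _ _ = contradiction p-prime ¬prime[1]
theorem14 p@(suc (suc m)) p-prime M N _ _ L (recurrence , _) with p ℕ.≤? L ℕ.+ suc L
... | yes p≤2L+1 = inj₁ (p-1≤2L L p≤2L+1)
... | no  p≰2L+1 with N ℕ.≤? L ℕ.+ suc L ℕ.+ L ℕ.+ p
...   | yes N≤3L+1+p = inj₂ (N-p-1≤3L p L N≤3L+1+p)
...   | no  N≰3L+1+p = ⊥-elim (noShortRecurrence p-prime M recurrence (ℕₚ.≰⇒> p≰2L+1) (ℕₚ.≰⇒> N≰3L+1+p))
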